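{- Let $G$ be a simple graph with $n \geq 3$ vertices and $m$ edges, with degree sequence $\Delta = d_1 \geq d_2 \geq \cdots \geq d_n = \delta > 0$. Then for any distinct indices $j \neq k$ in $\{1, \dots, n\}$, \[ M_1(G) \geq \frac{4m^2}{n} + \frac{1}{2}(d_j - d_k)^2 + \frac{2n}{n-2}\left(\frac{2m}{n} - \frac{d_j + d_k}{2}\right)^2. \]
   Context: The first Zagreb index is $M_1(G) = \sum_{i=1}^n d_i^2$, where $d_i$ is the degree of vertex $v_i$. -}

module Defs where

open import Data.Bool using (Bool; true; false; if_then_else_)
open import Data.Nat using (ℕ; zero; suc; _+_; _*_; _∸_; _≤_; _<_; s≤s; z≤n; NonZero)
open import Data.Nat.Properties using (_<?_)
open import Data.Fin using (Fin; toℕ)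
open import Data.List using (List; map; allFin)
open import Data.Nat.ListAction using (sum)
open import Relation.Binary.PropositionalEquality using (_≡_)
open import Relation.Nullary.Decidable using (does)

record SimpleGraph (n : ℕ) : Set where
  field
    adj    : Fin n → Fin n → Bool
    sym    : ∀ i j → adj i j ≡ adj j i
    irrefl : ∀ i → adj i i ≡ false
open SimpleGraph public

countB : {n : ℕ} → (Fin n → Bool) → ℕ
countB {n} p = sum (map (λ j → if p j then 1 else 0) (allFin n))

deg : {n : ℕ} → SimpleGraph n → Fin n → ℕ
deg G i = countB (adj G i)

edges : {n : ℕ} → SimpleGraph n → ℕ
edges {n} G = sum (map (λ i → countB (λ j → if does (toℕ i <? toℕ j) then adj G i j else false)) (allFin n))

M₁ : {n : ℕ} → SimpleGraph n → ℕ
M₁ {n} G = sum (map (λ i → deg G i * deg G i) (allFin n))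

nz-n : {n : ℕ} → 3 ≤ n → NonZero n
nz-n (s≤s _) = _

nz-n∸2 : {n : ℕ} → 3 ≤ n → NonZero (n ∸ 2)
nz-n∸2 (s≤s (s≤s (s≤s _))) = _

-- Let R = 2m − d_j − d_k be the sum of the other n − 2 degrees (handshake lemma).  By
-- Cauchy–Schwarz their squares sum to at least R²/(n − 2), so M₁ ≥ d_j² + d_k² + R²/(n − 2).
-- Once 2m is replaced by d_j + d_k + R, the right-hand side of the bound equals this quantity
-- identically.

module Submission where

module Combinatorics where

  import Algebra.Properties.CommutativeMonoid.Sum as Sum
  open import Data.Bool using (Bool; true; false; if_then_else_)
  open import Data.Fin using (Fin; zero; suc; toℕ; punchIn; punchOut)
  open import Data.Fin.Properties using (punchIn-punchOut; toℕ-injective)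
  open import Data.List using (map; allFin; tabulate)
  open import Data.List.Properties using (map-tabulate)
  open import Data.Nat using (ℕ; zero; suc; _+_; _*_; _≤_; _<ᵇ_; _<?_)
  import Data.Nat.ListAction as List
  open import Data.Nat.Properties
  open import Data.Nat.Tactic.RingSolver using (solve-∀)
  open import Data.Product using (_,_)
  open import Data.Sum using ([_,_]′)
  open import Data.Vec.Functional using (Vector)
  open import Function using (id; _∘_)
  open import Relation.Binary.PropositionalEquality
  open import Relation.Nullary using (does; contradiction)
  open import Relation.Nullary.Reflects using (ofʸ; ofⁿ)

  open import Defs using (SimpleGraph; adj; deg; edges)

  open Sum +-0-commutativeMonoid public using (sum)
  open Sum +-0-commutativeMonoid using (sum-syntax; ∑-distrib-+; ∑-comm; sum-remove; sum-cong-≗)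

  sum-tabulate : ∀ {n} (f : Fin n → ℕ) → List.sum (tabulate f) ≡ sum f
  sum-tabulate {zero}  f = refl
  sum-tabulate {suc n} f = cong (f zero +_) (sum-tabulate (f ∘ suc))

  sum-allFin : ∀ {n} (f : Fin n → ℕ) → List.sum (map f (allFin n)) ≡ sum f
  sum-allFin f = trans (cong List.sum (map-tabulate id f)) (sum-tabulate f)

  skip₂ : ∀ {n} {i j : Fin (suc (suc n))} → i ≢ j → Fin n → Fin (suc (suc n))
  skip₂ {i = i} i≢j = punchIn i ∘ punchIn (punchOut i≢j)

  sum-pick₂ : ∀ {n} (t : Vector ℕ (suc (suc n))) {i j} (i≢j : i ≢ j) →
              sum t ≡ t i + t j + sum (t ∘ skip₂ i≢j)
  sum-pick₂ {n} t {i} {j} i≢j = begin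
    sum t                                 ≡⟨ sum-remove t ⟩
    t i + sum (t ∘ punchIn i)             ≡⟨ cong (t i +_) (sum-remove (t ∘ punchIn i)) ⟩
    t i + (t (punchIn i j′) + rest)       ≡⟨ cong (λ l → t i + (t l + rest)) (punchIn-punchOut i≢j) ⟩
    t i + (t j + rest)                    ≡⟨ +-assoc (t i) (t j) rest ⟨
    t i + t j + rest                      ∎
    where
    open ≡-Reasoning
    j′ : Fin (suc n)
    j′ = punchOut i≢j
    rest : ℕ
    rest = sum (t ∘ skip₂ i≢j)

  2*m*n≤m*m+n*n : ∀ m n → 2 * m * n ≤ m * m + n * n
  2*m*n≤m*m+n*n m n = [ ordered , reversed ]′ (≤-total m n)
    where
    ordered : ∀ {m n} → m ≤ n → 2 * m * n ≤ m * m + n * n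
    ordered {m} m≤n with m≤n⇒∃[o]m+o≡n m≤n
    ... | o , refl = subst (2 * m * (m + o) ≤_) (expand m o) (m≤m+n _ (o * o))
      where
      expand : ∀ m o → 2 * m * (m + o) + o * o ≡ m * m + (m + o) * (m + o)
      expand = solve-∀
    reversed : n ≤ m → 2 * m * n ≤ m * m + n * n
    reversed n≤m = subst₂ _≤_ (swap n m) (+-comm (n * n) (m * m)) (ordered n≤m)
      where
      swap : ∀ n m → 2 * n * m ≡ 2 * m * n
      swap = solve-∀

  2*a*sum≤n*a*a+sum-sq : ∀ {n} (r : Vector ℕ n) a →
                         2 * a * sum r ≤ n * (a * a) + sum (λ i → r i * r i)
  2*a*sum≤n*a*a+sum-sq {zero}  r a = ≤-reflexive (*-zeroʳ (2 * a))
  2*a*sum≤n*a*a+sum-sq {suc n} r a =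
    subst₂ _≤_ (sym (*-distribˡ-+ (2 * a) (r zero) (sum (r ∘ suc)))) (regroup (a * a) (r zero * r zero) _ _)
      (+-mono-≤ (2*m*n≤m*m+n*n a (r zero)) (2*a*sum≤n*a*a+sum-sq (r ∘ suc) a))
    where
    regroup : ∀ a² r₀² x y → a² + r₀² + (x + y) ≡ (a² + x) + (r₀² + y)
    regroup = solve-∀

  cauchy-schwarz : ∀ {n} (r : Vector ℕ n) → sum r * sum r ≤ n * sum (λ i → r i * r i)
  cauchy-schwarz {zero}  r = ≤-refl
  cauchy-schwarz {suc n} r =
    subst₂ _≤_ (square r₀ S) (regroup (r₀ * r₀) Q n)
      (+-monoʳ-≤ (r₀ * r₀) (+-mono-≤ (2*a*sum≤n*a*a+sum-sq (r ∘ suc) r₀) (cauchy-schwarz (r ∘ suc))))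
    where
    r₀ S Q : ℕ
    r₀ = r zero
    S = sum (r ∘ suc)
    Q = sum (λ i → r (suc i) * r (suc i))
    square : ∀ a s → a * a + (2 * a * s + s * s) ≡ (a + s) * (a + s)
    square = solve-∀
    regroup : ∀ a² q n → a² + ((n * a² + q) + n * q) ≡ (1 + n) * (a² + q)
    regroup = solve-∀

  𝟙 : Bool → ℕ
  𝟙 b = if b then 1 else 0

  module _ {n : ℕ} (G : SimpleGraph n) where

    adj< : Fin n → Fin n → Bool
    adj< i j = if does (toℕ i <? toℕ j) then adj G i j else false

    𝟙-adj-split : ∀ i j → 𝟙 (adj G i j) ≡ 𝟙 (adj< i j) + 𝟙 (adj< j i)
    𝟙-adj-split i j
      with toℕ i <ᵇ toℕ j | <ᵇ-reflects-< (toℕ i) (toℕ j) | toℕ j <ᵇ toℕ i | <ᵇ-reflects-< (toℕ j) (toℕ i)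
    ... | true  | ofʸ i<j | true  | ofʸ j<i = contradiction j<i (<-asym i<j)
    ... | true  | _       | false | _       = sym (+-identityʳ _)
    ... | false | _       | true  | _       = cong 𝟙 (SimpleGraph.sym G i j)
    ... | false | ofⁿ i≮j | false | ofⁿ j≮i with toℕ-injective (≤-antisym (≮⇒≥ j≮i) (≮⇒≥ i≮j))
    ...   | refl = cong 𝟙 (SimpleGraph.irrefl G i)

    deg-sum : ∀ i → deg G i ≡ ∑[ j < n ] 𝟙 (adj G i j)
    deg-sum i = sum-allFin (λ j → 𝟙 (adj G i j))

    edges-sum : edges G ≡ ∑[ i < n ] ∑[ j < n ] 𝟙 (adj< i j)
    edges-sum = trans (sum-allFin (λ i → List.sum (map (λ j → 𝟙 (adj< i j)) (allFin n))))
                      (sum-cong-≗ (λ i → sum-allFin (λ j → 𝟙 (adj< i j))))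

    handshake : sum (deg G) ≡ 2 * edges G
    handshake = begin
      sum (deg G)
        ≡⟨ sum-cong-≗ (λ i → trans (deg-sum i) (sum-cong-≗ (𝟙-adj-split i))) ⟩
      ∑[ i < n ] ∑[ j < n ] (𝟙 (adj< i j) + 𝟙 (adj< j i))
        ≡⟨ sum-cong-≗ (λ i → ∑-distrib-+ (λ j → 𝟙 (adj< i j)) (λ j → 𝟙 (adj< j i))) ⟩
      ∑[ i < n ] (∑[ j < n ] 𝟙 (adj< i j) + ∑[ j < n ] 𝟙 (adj< j i))
        ≡⟨ ∑-distrib-+ (λ i → ∑[ j < n ] 𝟙 (adj< i j)) (λ i → ∑[ j < n ] 𝟙 (adj< j i)) ⟩
      m + ∑[ i < n ] ∑[ j < n ] 𝟙 (adj< j i)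
        ≡⟨ cong (m +_) (∑-comm (λ i j → 𝟙 (adj< j i))) ⟩
      m + m
        ≡⟨ cong (m +_) (+-identityʳ m) ⟨
      2 * m
        ≡⟨ cong (2 *_) edges-sum ⟨
      2 * edges G
        ∎
      where
      open ≡-Reasoning
      m : ℕ
      m = ∑[ i < n ] ∑[ j < n ] 𝟙 (adj< i j)

open import Data.Fin using (Fin; toℕ)
open import Data.Integer using (+_)
import Data.Integer as ℤ
import Data.Integer.Properties as ℤ
open import Data.Nat as N using (ℕ; suc; _∸_; _≤_; _<_; s≤s)
import Data.Nat.Properties as NP
open import Data.Nat.Tactic.RingSolver using (solve-∀)
open import Data.Product using (_,_)
open import Data.Rational using (ℚ; _/_; _+_; _-_; _*_; 1ℚ; ½; toℚᵘ)
import Data.Rational as Q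
open import Data.Rational.Properties
  using (toℚᵘ-injective; toℚᵘ-fromℚᵘ; toℚᵘ-homo-+; toℚᵘ-homo-*; toℚᵘ-cancel-≤; +-monoʳ-≤; module ≤-Reasoning)
open import Data.Rational.Solver using (module +-*-Solver)
open import Data.Rational.Unnormalised as ℚᵘ using (*≡*; *≤*) renaming (_≃_ to _≃ᵘ_; _/_ to _/ᵘ_)
import Data.Rational.Unnormalised.Properties as ℚᵘ
open import Data.Vec.Functional using (Vector)
open import Function using (_∘_)
open import Relation.Binary.PropositionalEquality

open import Defs using (SimpleGraph; deg; edges; M₁; nz-n; nz-n∸2)
open Combinatorics

toℚ : ℕ → ℚ
toℚ a = + a / 1

toℚᵘ-/ : ∀ i d → toℚᵘ (i / suc d) ≃ᵘ i /ᵘ suc d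
toℚᵘ-/ i d = toℚᵘ-fromℚᵘ (i /ᵘ suc d)

toℚ-homo-+ : ∀ a b → toℚ (a N.+ b) ≡ toℚ a + toℚ b
toℚ-homo-+ a b = toℚᵘ-injective (begin-equality
  toℚᵘ (toℚ (a N.+ b))              ≃⟨ toℚᵘ-/ (+ (a N.+ b)) 0 ⟩
  + (a N.+ b) /ᵘ 1                  ≃⟨ *≡* (cong (ℤ._* + 1) (trans (ℤ.pos-+ a b) (sym +a*1+b*1≡a+b))) ⟩
  (+ a /ᵘ 1) ℚᵘ.+ (+ b /ᵘ 1)        ≃⟨ ℚᵘ.+-cong (toℚᵘ-/ (+ a) 0) (toℚᵘ-/ (+ b) 0) ⟨
  toℚᵘ (toℚ a) ℚᵘ.+ toℚᵘ (toℚ b)    ≃⟨ toℚᵘ-homo-+ (toℚ a) (toℚ b) ⟨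
  toℚᵘ (toℚ a + toℚ b)              ∎)
  where
  open ℚᵘ.≤-Reasoning
  +a*1+b*1≡a+b : + a ℤ.* + 1 ℤ.+ + b ℤ.* + 1 ≡ + a ℤ.+ + b
  +a*1+b*1≡a+b = cong₂ ℤ._+_ (ℤ.*-identityʳ (+ a)) (ℤ.*-identityʳ (+ b))

toℚ-homo-* : ∀ a b → toℚ (a N.* b) ≡ toℚ a * toℚ b
toℚ-homo-* a b = toℚᵘ-injective (begin-equality
  toℚᵘ (toℚ (a N.* b))              ≃⟨ toℚᵘ-/ (+ (a N.* b)) 0 ⟩
  + (a N.* b) /ᵘ 1                  ≃⟨ *≡* (cong (ℤ._* + 1) (ℤ.pos-* a b)) ⟩
  (+ a /ᵘ 1) ℚᵘ.* (+ b /ᵘ 1)        ≃⟨ ℚᵘ.*-cong (toℚᵘ-/ (+ a) 0) (toℚᵘ-/ (+ b) 0) ⟨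
  toℚᵘ (toℚ a) ℚᵘ.* toℚᵘ (toℚ b)    ≃⟨ toℚᵘ-homo-* (toℚ a) (toℚ b) ⟨
  toℚᵘ (toℚ a * toℚ b)              ∎)
  where open ℚᵘ.≤-Reasoning

/-split : ∀ a d → + a / suc d ≡ toℚ a * (+ 1 / suc d)
/-split a d = toℚᵘ-injective (begin-equality
  toℚᵘ (+ a / suc d)                      ≃⟨ toℚᵘ-/ (+ a) d ⟩
  + a /ᵘ suc d                            ≃⟨ *≡* (cong₂ ℤ._*_ a≡a*1 (cong (+_ ∘ suc) (NP.+-identityʳ d))) ⟩
  (+ a /ᵘ 1) ℚᵘ.* (+ 1 /ᵘ suc d)          ≃⟨ ℚᵘ.*-cong (toℚᵘ-/ (+ a) 0) (toℚᵘ-/ (+ 1) d) ⟨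
  toℚᵘ (toℚ a) ℚᵘ.* toℚᵘ (+ 1 / suc d)    ≃⟨ toℚᵘ-homo-* (toℚ a) (+ 1 / suc d) ⟨
  toℚᵘ (toℚ a * (+ 1 / suc d))            ∎)
  where
  open ℚᵘ.≤-Reasoning
  a≡a*1 : + a ≡ + a ℤ.* + 1
  a≡a*1 = sym (ℤ.*-identityʳ (+ a))

n/n≡1 : ∀ d → + suc d / suc d ≡ 1ℚ
n/n≡1 d = toℚᵘ-injective (ℚᵘ.≃-trans (toℚᵘ-/ (+ suc d) d) (*≡* (ℤ.*-comm (+ suc d) (+ 1))))

/≤toℚ : ∀ a b d → a ≤ suc d N.* b → + a / suc d Q.≤ toℚ b
/≤toℚ a b d a≤db = toℚᵘ-cancel-≤ (begin
  toℚᵘ (+ a / suc d)   ≃⟨ toℚᵘ-/ (+ a) d ⟩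
  + a /ᵘ suc d         ≤⟨ *≤* (subst₂ ℤ._≤_ (sym (ℤ.*-identityʳ (+ a))) (ℤ.pos-* b (suc d)) (ℤ.+≤+ a≤bd)) ⟩
  + b /ᵘ 1             ≃⟨ toℚᵘ-/ (+ b) 0 ⟨
  toℚᵘ (toℚ b)         ∎)
  where
  open ℚᵘ.≤-Reasoning
  a≤bd : a ≤ b N.* suc d
  a≤bd = subst (a ≤_) (NP.*-comm (suc d) b) a≤db

-- The two sides differ by a combination of (2 + K) u − 1 and K v − 1.
bound-identity : ∀ K u v x y r → (toℚ 2 + K) * u ≡ 1ℚ → K * v ≡ 1ℚ →
  let s = x + y
      w = s + r
      t = w * u - s * ½
  in w * w * u + ½ * ((x - y) * (x - y)) + toℚ 2 * (toℚ 2 + K) * v * (t * t)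
     ≡ x * x + y * y + r * r * v
bound-identity K u v x y r [2+K]u≡1 Kv≡1 = begin
  w * w * u + ½ * ((x - y) * (x - y)) + toℚ 2 * N * v * (t * t)
    ≡⟨ certificate K u v x y r ⟩
  RHS + (N * u - 1ℚ) * A + (K * v - 1ℚ) * B
    ≡⟨ cong₂ (λ e f → RHS + (e - 1ℚ) * A + (f - 1ℚ) * B) [2+K]u≡1 Kv≡1 ⟩
  RHS + (1ℚ - 1ℚ) * A + (1ℚ - 1ℚ) * B
    ≡⟨ vanish RHS A B ⟩
  RHS
    ∎
  where
  open ≡-Reasoning
  open +-*-Solver
  N s w t RHS A B : ℚ
  N = toℚ 2 + K
  s = x + y
  w = s + r
  t = w * u - s * ½
  RHS = x * x + y * y + r * r * v
  A = w * w * (toℚ 2 * u * v + v) - toℚ 2 * v * w * s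
  B = ½ * s * s - u * w * w
  certificate : ∀ K u v x y r → let N = toℚ 2 + K; s = x + y; w = s + r; t = w * u - s * ½ in
    w * w * u + ½ * ((x - y) * (x - y)) + toℚ 2 * N * v * (t * t)
    ≡ x * x + y * y + r * r * v
      + (N * u - 1ℚ) * (w * w * (toℚ 2 * u * v + v) - toℚ 2 * v * w * s)
      + (K * v - 1ℚ) * (½ * s * s - u * w * w)
  certificate = solve 6 (λ K u v x y r →
    let two = con (toℚ 2); N = two :+ K; s = x :+ y; w = s :+ r; t = w :* u :- s :* con ½ in
    w :* w :* u :+ con ½ :* ((x :- y) :* (x :- y)) :+ two :* N :* v :* (t :* t)
    := x :* x :+ y :* y :+ r :* r :* v
       :+ (N :* u :- con 1ℚ) :* (w :* w :* (two :* u :* v :+ v) :- two :* v :* w :* s)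
       :+ (K :* v :- con 1ℚ) :* (con ½ :* s :* s :- u :* w :* w)) refl
  vanish : ∀ T A B → T + (1ℚ - 1ℚ) * A + (1ℚ - 1ℚ) * B ≡ T
  vanish = solve 3 (λ T A B → T :+ (con 1ℚ :- con 1ℚ) :* A :+ (con 1ℚ :- con 1ℚ) :* B := T) refl

sum-sq-lower-bound : ∀ {c} (t : Vector ℕ (3 N.+ c)) {i j} (i≢j : i ≢ j) →
  let r = toℚ (sum (t ∘ skip₂ i≢j)) in
  toℚ (t i) * toℚ (t i) + toℚ (t j) * toℚ (t j) + r * r * (+ 1 / suc c)
    Q.≤ toℚ (sum (λ l → t l N.* t l))
sum-sq-lower-bound {c} t {i} {j} i≢j = begin
  X * X + Y * Y + r * r * v       ≤⟨ +-monoʳ-≤ (X * X + Y * Y) r²/[1+c]≤Q ⟩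
  X * X + Y * Y + toℚ Q           ≡⟨ toℚ-sum-sq ⟨
  toℚ (sum (λ l → t l N.* t l))   ∎
  where
  open ≤-Reasoning
  R Q : ℕ
  R = sum (t ∘ skip₂ i≢j)
  Q = sum (λ l → t (skip₂ i≢j l) N.* t (skip₂ i≢j l))
  X Y r v : ℚ
  X = toℚ (t i)
  Y = toℚ (t j)
  r = toℚ R
  v = + 1 / suc c
  r²/[1+c]≤Q : r * r * v Q.≤ toℚ Q
  r²/[1+c]≤Q = subst (Q._≤ toℚ Q) (trans (/-split (R N.* R) c) (cong (_* v) (toℚ-homo-* R R)))
                 (/≤toℚ (R N.* R) Q c (cauchy-schwarz (t ∘ skip₂ i≢j)))
  toℚ-sum-sq : toℚ (sum (λ l → t l N.* t l)) ≡ X * X + Y * Y + toℚ Q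
  toℚ-sum-sq = begin-equality
    toℚ (sum (λ l → t l N.* t l))
      ≡⟨ cong toℚ (sum-pick₂ (λ l → t l N.* t l) i≢j) ⟩
    toℚ (t i N.* t i N.+ t j N.* t j N.+ Q)
      ≡⟨ toℚ-homo-+ (t i N.* t i N.+ t j N.* t j) Q ⟩
    toℚ (t i N.* t i N.+ t j N.* t j) + toℚ Q
      ≡⟨ cong (_+ toℚ Q) (toℚ-homo-+ (t i N.* t i) (t j N.* t j)) ⟩
    toℚ (t i N.* t i) + toℚ (t j N.* t j) + toℚ Q
      ≡⟨ cong₂ (λ p q → p + q + toℚ Q) (toℚ-homo-* (t i) (t i)) (toℚ-homo-* (t j) (t j)) ⟩
    X * X + Y * Y + toℚ Q
      ∎

bound≡x²+y²+R²/[n∸2] : ∀ c m x y R → 2 N.* m ≡ x N.+ y N.+ R →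
  let n = 3 N.+ c
      X = toℚ x
      Y = toℚ y
      t = + (2 N.* m) / n - + (x N.+ y) / 2
  in + (4 N.* m N.* m) / n + ½ * ((X - Y) * (X - Y)) + + (2 N.* n) / suc c * (t * t)
     ≡ X * X + Y * Y + toℚ R * toℚ R * (+ 1 / suc c)
bound≡x²+y²+R²/[n∸2] c m x y R 2m≡x+y+R = begin
  bound (+ (4 N.* m N.* m) / n) (+ (2 N.* m) / n) (+ (x N.+ y) / 2) (+ (2 N.* n) / suc c)
    ≡⟨ cong₂ (λ (a , b) (p , e) → bound a b p e) (cong₂ _,_ 4m²/n 2m/n) (cong₂ _,_ [x+y]/2 2n/[1+c]) ⟩
  bound (w * w * u) (w * u) (s * ½) (toℚ 2 * (toℚ 2 + K) * v)
    ≡⟨ bound-identity K u v X Y r [2+K]u≡1 Kv≡1 ⟩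
  X * X + Y * Y + r * r * v
    ∎
  where
  open ≡-Reasoning
  n : ℕ
  n = 3 N.+ c
  X Y r K u v s w : ℚ
  X = toℚ x
  Y = toℚ y
  r = toℚ R
  K = toℚ (suc c)
  u = + 1 / n
  v = + 1 / suc c
  s = X + Y
  w = s + r
  bound : ℚ → ℚ → ℚ → ℚ → ℚ
  bound a b p e = a + ½ * ((X - Y) * (X - Y)) + e * ((b - p) * (b - p))
  toℚ-2m : toℚ (2 N.* m) ≡ w
  toℚ-2m = trans (cong toℚ 2m≡x+y+R) (trans (toℚ-homo-+ (x N.+ y) R) (cong (_+ r) (toℚ-homo-+ x y)))
  4m²/n : + (4 N.* m N.* m) / n ≡ w * w * u
  4m²/n = trans (/-split (4 N.* m N.* m) (2 N.+ c)) (cong (_* u) (begin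
    toℚ (4 N.* m N.* m)                ≡⟨ cong toℚ (square m) ⟩
    toℚ (2 N.* m N.* (2 N.* m))        ≡⟨ toℚ-homo-* (2 N.* m) (2 N.* m) ⟩
    toℚ (2 N.* m) * toℚ (2 N.* m)      ≡⟨ cong₂ _*_ toℚ-2m toℚ-2m ⟩
    w * w                              ∎))
    where
    square : ∀ m → 4 N.* m N.* m ≡ 2 N.* m N.* (2 N.* m)
    square = solve-∀
  2m/n : + (2 N.* m) / n ≡ w * u
  2m/n = trans (/-split (2 N.* m) (2 N.+ c)) (cong (_* u) toℚ-2m)
  [x+y]/2 : + (x N.+ y) / 2 ≡ s * ½
  [x+y]/2 = trans (/-split (x N.+ y) 1) (cong (_* ½) (toℚ-homo-+ x y))
  2n/[1+c] : + (2 N.* n) / suc c ≡ toℚ 2 * (toℚ 2 + K) * v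
  2n/[1+c] = trans (/-split (2 N.* n) c)
    (cong (_* v) (trans (toℚ-homo-* 2 n) (cong (toℚ 2 *_) (toℚ-homo-+ 2 (suc c)))))
  [2+K]u≡1 : (toℚ 2 + K) * u ≡ 1ℚ
  [2+K]u≡1 = trans (cong (_* u) (sym (toℚ-homo-+ 2 (suc c))))
    (trans (sym (/-split n (2 N.+ c))) (n/n≡1 (2 N.+ c)))
  Kv≡1 : K * v ≡ 1ℚ
  Kv≡1 = trans (sym (/-split (suc c) c)) (n/n≡1 c)

corollary1 :
    (n : ℕ) (h : 3 ≤ n) (G : SimpleGraph n) →
    (∀ i j → toℕ i ≤ toℕ j → deg G j ≤ deg G i) →
    (∀ i → 0 < deg G i) →
    (j k : Fin n) → j ≢ k →
    let m = edges G
        dj = + deg G j / 1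
        dk = + deg G k / 1
        t = (_/_ (+ (2 N.* m)) n {{nz-n h}}) - (+ (deg G j N.+ deg G k) / 2)
    in (_/_ (+ (4 N.* m N.* m)) n {{nz-n h}})
         + ((+ 1 / 2) * ((dj - dk) * (dj - dk)))
         + (_/_ (+ (2 N.* n)) (n ∸ 2) {{nz-n∸2 h}}) * (t * t)
       Q.≤ (+ M₁ G / 1)
corollary1 (suc (suc (suc c))) (s≤s (s≤s (s≤s _))) G _ _ j k j≢k =
  subst₂ Q._≤_
    (sym (bound≡x²+y²+R²/[n∸2] c (edges G) (deg G j) (deg G k) _ 2m-split))
    (cong toℚ (sym (sum-allFin (λ i → deg G i N.* deg G i))))
    (sum-sq-lower-bound (deg G) j≢k)
  where
  2m-split : 2 N.* edges G ≡ deg G j N.+ deg G k N.+ sum (deg G ∘ skip₂ j≢k)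
  2m-split = trans (sym (handshake G)) (sum-pick₂ (deg G) j≢k)
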